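{- Let $H$ be a graph of radius three with $\dim_l(K_1+H)=2$. Then the vertex of $K_1$ does not belong to any local metric basis for $K_1+H$.
   Context: All graphs are finite and simple. For a connected graph $X$, $d_X(x,y)$ is the length of a shortest path between $x$ and $y$. A vertex $w$ distinguishes two vertices $x,y$ if $d_X(w,x)\ne d_X(w,y)$. A set $S\subseteq V(X)$ is a local metric generator for $X$ if every two adjacent vertices of $X$ are distinguished by some vertex of $S$; a local metric generator of minimum cardinality is a local metric basis, and its cardinality is the local metric dimension $\dim_l(X)$. The join $K_1+H$ is obtained from $H$ by adding one new vertex (the vertex of $K_1$) adjacent to every vertex of $H$. -}

module Defs where

open import Data.Nat using (ℕ; zero; suc; _≤_)
open import Data.Fin using (Fin; zero; suc)
open import Data.Fin.Subset using (Subset; _∈_; ∣_∣)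
open import Data.Bool using (Bool; true; false; T)
open import Data.Product using (Σ; ∃; _×_; _,_)
open import Relation.Binary.PropositionalEquality using (_≡_; _≢_)
open import Relation.Nullary using (¬_)

record Graph (n : ℕ) : Set where
  field
    Adj   : Fin n → Fin n → Bool
    sym   : ∀ x y → Adj x y ≡ Adj y x
    irref : ∀ x → Adj x x ≡ false
open Graph public

data Walk {n : ℕ} (G : Graph n) : Fin n → Fin n → ℕ → Set where
  here : ∀ {x} → Walk G x x 0
  step : ∀ {x y z k} → T (Adj G x y) → Walk G y z k → Walk G x z (suc k)

Dist : ∀ {n} → Graph n → Fin n → Fin n → ℕ → Set
Dist G x y k = Walk G x y k × (∀ m → Walk G x y m → k ≤ m)

Ecc : ∀ {n} → Graph n → Fin n → ℕ → Set
Ecc G v e = (∀ w → ∃ λ d → Dist G v w d × d ≤ e) × (∃ λ w → Dist G v w e)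

-- radius of G is r (minimum eccentricity; this forces G connected)
Radius : ∀ {n} → Graph n → ℕ → Set
Radius G r = (∃ λ v → Ecc G v r) × (∀ u e → Ecc G u e → r ≤ e)

-- join K₁ + H : new vertex is `zero`, vertices of H are `suc i`
joinAdj : ∀ {n} → Graph n → Fin (suc n) → Fin (suc n) → Bool
joinAdj H zero    zero    = false
joinAdj H zero    (suc j) = true
joinAdj H (suc i) zero    = true
joinAdj H (suc i) (suc j) = Adj H i j

joinSym : ∀ {n} (H : Graph n) x y → joinAdj H x y ≡ joinAdj H y x
joinSym H zero    zero    = _≡_.refl
joinSym H zero    (suc j) = _≡_.refl
joinSym H (suc i) zero    = _≡_.refl
joinSym H (suc i) (suc j) = sym H i j

joinIrr : ∀ {n} (H : Graph n) x → joinAdj H x x ≡ false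
joinIrr H zero    = _≡_.refl
joinIrr H (suc i) = irref H i

K1+ : ∀ {n} → Graph n → Graph (suc n)
K1+ H = record { Adj = joinAdj H ; sym = joinSym H ; irref = joinIrr H }

Distinguishes : ∀ {n} → Graph n → Fin n → Fin n → Fin n → Set
Distinguishes G w x y = ∀ a b → Dist G w x a → Dist G w y b → a ≢ b

LocalMetricGenerator : ∀ {n} → Graph n → Subset n → Set
LocalMetricGenerator G S =
  ∀ x y → T (Adj G x y) → ∃ λ w → w ∈ S × Distinguishes G w x y

LocalMetricBasis : ∀ {n} → Graph n → Subset n → Set
LocalMetricBasis G S =
  LocalMetricGenerator G S × (∀ T → LocalMetricGenerator G T → ∣ S ∣ ≤ ∣ T ∣)

LocalDim : ∀ {n} → Graph n → ℕ → Set
LocalDim G k = ∃ λ S → LocalMetricBasis G S × ∣ S ∣ ≡ k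

-- In K₁ + H the apex is at distance 1 from every vertex of H, so it distinguishes no edge of H.
-- A local metric basis of size 2 containing the apex therefore has a single vertex v of H that
-- distinguishes every edge of H.  Seen from v in the join, a vertex of H lies at distance 0, 1
-- (the neighbours of v) or 2 (all others), so no edge of H joins two non-neighbours of v.  As
-- every vertex u of H has a neighbour, a non-neighbour u ≠ v has a neighbour adjacent to v, and
-- d_H(v, u) = 2.  Hence v has eccentricity at most 2 in H, contradicting radius three.
module Submission where

open import Defs
open import Data.Nat using (zero; suc; _≤_; z≤n; s≤s)
open import Data.Nat.Properties
  using (≤-refl; ≤-trans; m≤n⇒m≤1+n; m<1+n⇒m≤n; ≤∧≢⇒<; ≤⇒≯)
  renaming (_≟_ to _≟ℕ_)
open import Data.Fin using (Fin; zero; suc)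
open import Data.Fin.Properties using (any?; suc-injective; _≟_)
open import Data.Fin.Subset using (Subset; _∈_; ∣_∣; _-_)
open import Data.Fin.Subset.Properties using (x∈p⇒∣p-x∣<∣p∣; x∈p∧x≢y⇒x∈p-y)
open import Data.Bool using (T)
open import Data.Product using (∃; _×_; _,_; proj₁; proj₂)
open import Relation.Binary.PropositionalEquality using (_≢_; refl; subst)
open import Relation.Nullary using (¬_; yes; no; contradiction)
open import Relation.Nullary.Decidable using (T?)

three-members⇒3≤∣p∣ : ∀ {n} {p : Subset n} {x y z} → x ∈ p → y ∈ p → z ∈ p →
                      y ≢ x → z ≢ x → z ≢ y → 3 ≤ ∣ p ∣
three-members⇒3≤∣p∣ {p = p} {x} {y} x∈p y∈p z∈p y≢x z≢x z≢y =
  ≤-trans (s≤s (≤-trans (s≤s 1≤∣p-x-y∣) (x∈p⇒∣p-x∣<∣p∣ y∈p-x))) (x∈p⇒∣p-x∣<∣p∣ x∈p)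
  where
  y∈p-x : y ∈ p - x
  y∈p-x = x∈p∧x≢y⇒x∈p-y y∈p y≢x

  1≤∣p-x-y∣ : 1 ≤ ∣ p - x - y ∣
  1≤∣p-x-y∣ = ≤-trans (s≤s z≤n)
    (x∈p⇒∣p-x∣<∣p∣ (x∈p∧x≢y⇒x∈p-y (x∈p∧x≢y⇒x∈p-y z∈p z≢x) z≢y))

module _ {n} (G : Graph n) where

  Adj-symᵀ : ∀ {x y} → T (Adj G x y) → T (Adj G y x)
  Adj-symᵀ {x} {y} = subst T (sym G x y)

  Dist-refl : ∀ x → Dist G x x 0
  Dist-refl x = here , λ _ _ → z≤n

  Adj⇒Dist1 : ∀ {x y} → T (Adj G x y) → Dist G x y 1
  Adj⇒Dist1 {x} {y} x~y = step x~y here , shortest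
    where
    shortest : ∀ m → Walk G x y m → 1 ≤ m
    shortest zero    here = contradiction x~y (subst T (irref G x))
    shortest (suc m) _    = s≤s z≤n

  Walk2⇒Dist2 : ∀ {x y} → x ≢ y → ¬ T (Adj G x y) → Walk G x y 2 → Dist G x y 2
  Walk2⇒Dist2 {x} {y} x≢y x≁y walk = walk , shortest
    where
    shortest : ∀ m → Walk G x y m → 2 ≤ m
    shortest zero          here             = contradiction refl x≢y
    shortest (suc zero)    (step x~y here)  = contradiction x~y x≁y
    shortest (suc (suc m)) _                = s≤s (s≤s z≤n)

  Walk-suc⇒neighbourʳ : ∀ {x y k} → Walk G x y (suc k) → ∃ λ p → T (Adj G y p)
  Walk-suc⇒neighbourʳ {x} (step x~y here)     = x , Adj-symᵀ x~y
  Walk-suc⇒neighbourʳ (step _ (step y~z walk)) = Walk-suc⇒neighbourʳ (step y~z walk)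

  Ecc-suc⇒neighbour : ∀ {v e} → Ecc G v (suc e) → ∀ u → ∃ λ p → T (Adj G u p)
  Ecc-suc⇒neighbour (reach , _ , (step {y = p} v~p _ , _)) u with reach u
  ... | _ , (here , _) , _          = p , v~p
  ... | _ , (step v~w walk , _) , _ = Walk-suc⇒neighbourʳ (step v~w walk)

  Ecc-exists-≤ : ∀ {v} k → (∀ w → ∃ λ d → Dist G v w d × d ≤ k) → ∃ λ e → Ecc G v e × e ≤ k
  Ecc-exists-≤ {v} zero bounded = 0 , (bounded , v , Dist-refl v) , z≤n
  Ecc-exists-≤ {v} (suc k) bounded with any? (λ w → proj₁ (bounded w) ≟ℕ suc k)
  ... | yes (w , d≡k) = suc k , (bounded , w , subst (Dist G v w) d≡k (proj₁ (proj₂ (bounded w))))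
                      , ≤-refl
  ... | no unattained with Ecc-exists-≤ k tighter
    where
    tighter : ∀ w → ∃ λ d → Dist G v w d × d ≤ k
    tighter w = proj₁ (bounded w) , proj₁ (proj₂ (bounded w)) ,
      m<1+n⇒m≤n (≤∧≢⇒< (proj₂ (proj₂ (bounded w))) (λ d≡k → unattained (w , d≡k)))
  ... | e , ecc , e≤k = e , ecc , m≤n⇒m≤1+n e≤k

module _ {n} (H : Graph n) where

  DistinguishesAllEdges : Fin n → Set
  DistinguishesAllEdges v = ∀ x y → T (Adj H x y) → Distinguishes (K1+ H) (suc v) (suc x) (suc y)

  apex-distinguishes-nothing : ∀ x y → ¬ Distinguishes (K1+ H) zero (suc x) (suc y)
  apex-distinguishes-nothing x y distinguishes =
    distinguishes 1 1 (Adj⇒Dist1 (K1+ H) _) (Adj⇒Dist1 (K1+ H) _) refl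

  join-Dist2 : ∀ {x y} → x ≢ y → ¬ T (Adj H x y) → Dist (K1+ H) (suc x) (suc y) 2
  join-Dist2 x≢y x≁y =
    Walk2⇒Dist2 (K1+ H) (λ e → x≢y (suc-injective e)) x≁y (step {y = zero} _ (step _ here))

  edge-distinguisher : ∀ {S x y} → LocalMetricGenerator (K1+ H) S → T (Adj H x y) →
                       ∃ λ v → suc v ∈ S × Distinguishes (K1+ H) (suc v) (suc x) (suc y)
  edge-distinguisher {x = x} {y} generator x~y with generator (suc x) (suc y) x~y
  ... | zero  , _     , d = contradiction d (apex-distinguishes-nothing x y)
  ... | suc v , v∈S   , d = v , v∈S , d

  apex∈generator-of-size≤2⇒DistinguishesAllEdges :
    ∀ {S a b} → LocalMetricGenerator (K1+ H) S → zero ∈ S → ∣ S ∣ ≤ 2 → T (Adj H a b) →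
    ∃ DistinguishesAllEdges
  apex∈generator-of-size≤2⇒DistinguishesAllEdges {S} generator apex∈S ∣S∣≤2 a~b = v , distinguishes
    where
    v : Fin n
    v = proj₁ (edge-distinguisher generator a~b)

    v∈S : suc v ∈ S
    v∈S = proj₁ (proj₂ (edge-distinguisher generator a~b))

    distinguishes : DistinguishesAllEdges v
    distinguishes x y x~y with edge-distinguisher generator x~y
    ... | v′ , v′∈S , d with v′ ≟ v
    ...   | yes refl = d
    ...   | no v′≢v  = contradiction
      (three-members⇒3≤∣p∣ apex∈S v∈S v′∈S (λ ()) (λ ()) (λ e → v′≢v (suc-injective e)))
      (≤⇒≯ ∣S∣≤2)

  module _ {v} (distinguishes : DistinguishesAllEdges v)
               (neighbour : ∀ u → ∃ λ p → T (Adj H u p)) where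

    -- A neighbour p of u cannot be another non-neighbour of v: u and p would both lie at
    -- distance 2 from v in the join.
    non-neighbour⇒Dist2 : ∀ u → v ≢ u → ¬ T (Adj H v u) → Dist H v u 2
    non-neighbour⇒Dist2 u v≢u v≁u with neighbour u
    ... | p , u~p with T? (Adj H v p)
    ...   | yes v~p = Walk2⇒Dist2 H v≢u v≁u (step v~p (step (Adj-symᵀ H u~p) here))
    ...   | no v≁p with v ≟ p
    ...     | yes refl = contradiction (Adj-symᵀ H u~p) v≁u
    ...     | no v≢p   = contradiction refl
      (distinguishes u p u~p 2 2 (join-Dist2 v≢u v≁u) (join-Dist2 v≢p v≁p))

    within-distance-2 : ∀ w → ∃ λ d → Dist H v w d × d ≤ 2
    within-distance-2 w with v ≟ w
    ... | yes refl = 0 , Dist-refl H v , z≤n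
    ... | no v≢w with T? (Adj H v w)
    ...   | yes v~w = 1 , Adj⇒Dist1 H v~w , s≤s z≤n
    ...   | no v≁w  = 2 , non-neighbour⇒Dist2 w v≢w v≁w , ≤-refl

mainTheorem19 : ∀ {n} (H : Graph n) → Radius H 3 → LocalDim (K1+ H) 2 →
                  ∀ S → LocalMetricBasis (K1+ H) S → ¬ (zero ∈ S)
mainTheorem19 H ((c , ecc-c) , radius≤) (S₀ , (generator₀ , _) , ∣S₀∣≡2) S (generator , minimal) apex∈S =
  let v , distinguishes = apex∈generator-of-size≤2⇒DistinguishesAllEdges H generator apex∈S ∣S∣≤2
                            (proj₂ (neighbour c))
      e , ecc-v , e≤2   = Ecc-exists-≤ H 2 (within-distance-2 H distinguishes neighbour)
  in ≤⇒≯ e≤2 (radius≤ v e ecc-v)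
  where
  neighbour : ∀ u → ∃ λ p → T (Adj H u p)
  neighbour = Ecc-suc⇒neighbour H ecc-c

  ∣S∣≤2 : ∣ S ∣ ≤ 2
  ∣S∣≤2 = subst (∣ S ∣ ≤_) ∣S₀∣≡2 (minimal S₀ generator₀)
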